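{- Let $T$ be a binary tree and $L_1,L_2\subseteq\mathcal{L}(T)$. If $T|L_1$ and $T|L_2$ are edge sharing, then every edge $e$ of $T|(L_1\cup L_2)$ belongs to a path $\mathrm{path}_{T|L_1\cup L_2}(u,v)$ where $u,v\in L_1$ or $u,v\in L_2$.
   Context: A binary tree has all internal vertices of degree $3$ and labeled leaves $\mathcal{L}(T)$. $\mathrm{path}_T(x,y)$ is the set of edges on the path from $x$ to $y$ in $T$. For $L\subseteq\mathcal{L}(T)$, the restriction $T|L$ is the tree with leaf set $L$ obtained from the minimal subtree of $T$ spanning $L$ by suppressing degree-2 vertices (equivalently, whose splits are the restrictions to $L$ of the splits of $T$). $T|L_1$ and $T|L_2$ are edge disjoint if $\mathrm{path}_T(u_1,v_1)\cap\mathrm{path}_T(u_2,v_2)=\emptyset$ for all $u_1,v_1\in L_1$, $u_2,v_2\in L_2$, and edge sharing otherwise. -}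

module Defs where

open import Data.Nat using (ℕ)
open import Data.Empty using (⊥)
open import Data.Unit using (⊤)
open import Data.Sum using (_⊎_)
open import Data.Product using (_×_; ∃-syntax; _,_)
open import Relation.Nullary using (¬_)
open import Relation.Binary.PropositionalEquality using (_≡_)

-- Representation: an unrooted binary tree with at least two leaves is
-- presented by choosing one leaf r ("base leaf") and the rooted binary
-- tree t hanging off r.  Every vertex of t has an edge towards its parent
-- (the root of t is joined to r).  Internal vertices of t thus have
-- degree 3 (two children + parent); leaves of t and r have degree 1.
-- Every finite tree all of whose internal vertices have degree 3 arises
-- this way.  The one-vertex tree (a single leaf, no edges) is 'single'.

data RTree : Set where
  leaf : ℕ → RTree
  node : RTree → RTree → RTree

data BinTree : Set where
  single : ℕ → BinTree
  rooted : ℕ → RTree → BinTree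

data Occ (x : ℕ) : RTree → Set where
  here : Occ x (leaf x)
  inl  : ∀ {l r} → Occ x l → Occ x (node l r)
  inr  : ∀ {l r} → Occ x r → Occ x (node l r)

data DistinctR : RTree → Set where
  leaf : ∀ x → DistinctR (leaf x)
  node : ∀ {l r} → DistinctR l → DistinctR r →
         (∀ x → Occ x l → ¬ Occ x r) → DistinctR (node l r)

WellLabelled : BinTree → Set
WellLabelled (single x)   = ⊤
WellLabelled (rooted r t) = DistinctR t × ¬ Occ r t

Leaf : BinTree → ℕ → Set
Leaf (single x)   y = y ≡ x
Leaf (rooted r t) y = (y ≡ r) ⊎ Occ y t

_⊆Leaves_ : (ℕ → Set) → BinTree → Set
L ⊆Leaves T = ∀ x → L x → Leaf T x

_∪_ : (ℕ → Set) → (ℕ → Set) → ℕ → Set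
(A ∪ B) x = A x ⊎ B x

-- Edges.  An edge of 'rooted r t' is named by the vertex of t at its
-- lower (child) end, i.e. by a position in t.

data Pos : RTree → Set where
  here  : ∀ {t} → Pos t
  left  : ∀ {l r} → Pos l → Pos (node l r)
  right : ∀ {l r} → Pos r → Pos (node l r)

Edge : BinTree → Set
Edge (single x)   = ⊥
Edge (rooted r t) = Pos t

Below : ∀ {t} → Pos t → ℕ → Set
Below {t} here      x = Occ x t
Below (left p)  x = Below p x
Below (right p) x = Below p x

-- e ∈ path_T(x,y): the path between leaves x and y uses edge e iff
-- e separates x from y (exactly one of them lies below e); i.e. the
-- x–y path is the symmetric difference of the paths from the base leaf
-- r to x and to y (the edges of the r–x path are exactly those above x).
_∈path[_]⟨_,_⟩ : (T : BinTree) → Edge T → ℕ → ℕ → Set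
_∈path[_]⟨_,_⟩ (single z)   () x y
_∈path[_]⟨_,_⟩ (rooted r t) e  x y =
  (Below e x × ¬ Below e y) ⊎ (Below e y × ¬ Below e x)

EdgeSharing : (T : BinTree) → (ℕ → Set) → (ℕ → Set) → Set
EdgeSharing T L₁ L₂ =
  ∃[ u₁ ] ∃[ v₁ ] ∃[ u₂ ] ∃[ v₂ ] ∃[ e ]
    (L₁ u₁ × L₁ v₁ × L₂ u₂ × L₂ v₂ ×
     T ∈path[ e ]⟨ u₁ , v₁ ⟩ × T ∈path[ e ]⟨ u₂ , v₂ ⟩)

-- The restriction T|L.  Its edges are obtained from the edges of the
-- minimal subtree of T spanning L (the edges lying on some path between
-- two leaves of L) by suppressing degree-2 vertices: each edge of T|L is
-- a maximal chain of such T-edges.  We name an edge of T|L by any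
-- T-edge of that chain (a representative).  The edge of T|L lies on
-- path_{T|L}(u,v) (u,v ∈ L) iff its chain is contained in path_T(u,v)
-- iff (any) representative lies on path_T(u,v); this is independent of
-- the representative chosen.

RestrEdge : (T : BinTree) → (ℕ → Set) → Set
RestrEdge T L = ∃[ e ] ∃[ x ] ∃[ y ] (L x × L y × T ∈path[ e ]⟨ x , y ⟩)

OnRestrPath : (T : BinTree) (L : ℕ → Set) → RestrEdge T L → ℕ → ℕ → Set
OnRestrPath T L (e , _) u v = L u × L v × T ∈path[ e ]⟨ u , v ⟩

{-# OPTIONS --safe #-}
-- Root T at its base leaf, so that every edge e is described by the set of
-- leaves below it.  For distinct labels these sets form a laminar family.
-- Suppose e separates a ∈ L₁ from b ∈ L₂ (a below e) but separates no two
-- leaves of L₁ and no two of L₂.  Then all of L₁ lies below e and all of L₂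
-- outside.  The edge f shared by T|L₁ and T|L₂ separates two leaves of L₁,
-- both below e, so by laminarity everything below f is below e; but f also
-- separates two leaves of L₂, one of which then lies below e.
module Submission where

open import Defs
open import Level using (0ℓ)
open import Data.Nat using (ℕ)
open import Data.Nat.Properties using (_≟_)
open import Data.Sum using (_⊎_; inj₁; inj₂; swap)
open import Data.Product using (_×_; ∃-syntax; _,_; proj₁)
open import Relation.Nullary using (¬_; yes; no; contradiction)
open import Relation.Unary using (Pred; Decidable; _⊆_; _⊥_)
open import Relation.Binary.PropositionalEquality using (refl)

occ? : ∀ t → Decidable (λ x → Occ x t)
occ? (leaf y) x with x ≟ y
... | yes refl = yes here
... | no x≢y   = no λ { here → x≢y refl }
occ? (node l r) x with occ? l x | occ? r x
... | yes x∈l | _       = yes (inl x∈l)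
... | no _    | yes x∈r = yes (inr x∈r)
... | no x∉l  | no x∉r  = no λ { (inl x∈l) → x∉l x∈l ; (inr x∈r) → x∉r x∈r }

below? : ∀ {t} (p : Pos t) → Decidable (Below p)
below? {t} here    = occ? t
below? (left p)    = below? p
below? (right p)   = below? p

Below⇒Occ : ∀ {t} (p : Pos t) → Below p ⊆ (λ x → Occ x t)
Below⇒Occ here      x∈p = x∈p
Below⇒Occ (left p)  x∈p = inl (Below⇒Occ p x∈p)
Below⇒Occ (right p) x∈p = inr (Below⇒Occ p x∈p)

Below-laminar : ∀ {t} → DistinctR t → (p q : Pos t) →
                Below p ⊆ Below q ⊎ Below q ⊆ Below p ⊎ Below p ⊥ Below q
Below-laminar _ here q = inj₂ (inj₁ (Below⇒Occ q))
Below-laminar _ (left p)  here = inj₁ (Below⇒Occ (left p))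
Below-laminar _ (right p) here = inj₁ (Below⇒Occ (right p))
Below-laminar (node dl _ _) (left p)  (left q)  = Below-laminar dl p q
Below-laminar (node _ dr _) (right p) (right q) = Below-laminar dr p q
Below-laminar (node _ _ l#r) (left p) (right q) =
  inj₂ (inj₂ λ (x∈p , x∈q) → l#r _ (Below⇒Occ p x∈p) (Below⇒Occ q x∈q))
Below-laminar (node _ _ l#r) (right p) (left q) =
  inj₂ (inj₂ λ (x∈p , x∈q) → l#r _ (Below⇒Occ q x∈q) (Below⇒Occ p x∈p))

Separates : ∀ {t} → Pos t → ℕ → ℕ → Set
Separates e u v = Below e u × ¬ Below e v

Straddles : ∀ {t} → Pos t → Pred ℕ 0ℓ → Set
Straddles e L = ∃[ u ] ∃[ v ] (L u × L v × Separates e u v)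

separating⇒⊆ : ∀ {t} → DistinctR t → (e f : Pos t) {u v : ℕ} →
               Separates f u v → Below e u → Below e v → Below f ⊆ Below e
separating⇒⊆ d e f (u∈f , v∉f) u∈e v∈e with Below-laminar d f e
... | inj₁ f⊆e        = f⊆e
... | inj₂ (inj₁ e⊆f) = contradiction (e⊆f v∈e) v∉f
... | inj₂ (inj₂ f#e) = contradiction (u∈f , u∈e) f#e

straddles-or-below : ∀ {t} (e : Pos t) {L : Pred ℕ 0ℓ} {u : ℕ} →
                     L u → Below e u → ∀ {w} → L w → Straddles e L ⊎ Below e w
straddles-or-below e u∈L u∈e {w} w∈L with below? e w
... | yes w∈e = inj₂ w∈e
... | no w∉e  = inj₁ (_ , _ , u∈L , w∈L , u∈e , w∉e)

straddles-or-outside : ∀ {t} (e : Pos t) {L : Pred ℕ 0ℓ} {v : ℕ} →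
                       L v → ¬ Below e v → ∀ {w} → L w → Straddles e L ⊎ ¬ Below e w
straddles-or-outside e v∈L v∉e {w} w∈L with below? e w
... | yes w∈e = inj₁ (_ , _ , w∈L , v∈L , w∈e , v∉e)
... | no w∉e  = inj₂ w∉e

straddles-across : ∀ {t} → DistinctR t → (e f : Pos t) {L M : Pred ℕ 0ℓ} →
                   Straddles f L → Straddles f M → ∀ {a b} → L a → M b →
                   Separates e a b → Straddles e L ⊎ Straddles e M
straddles-across d e f (u , v , u∈L , v∈L , f-uv) (u′ , _ , u′∈M , _ , u′∈f , _)
                 a∈L b∈M (a∈e , b∉e)
  with straddles-or-below e a∈L a∈e u∈L | straddles-or-below e a∈L a∈e v∈L
     | straddles-or-outside e b∈M b∉e u′∈M
... | inj₁ eL | _        | _        = inj₁ eL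
... | inj₂ _  | inj₁ eL  | _        = inj₁ eL
... | inj₂ _  | inj₂ _   | inj₁ eM  = inj₂ eM
... | inj₂ u∈e | inj₂ v∈e | inj₂ u′∉e =
  contradiction (separating⇒⊆ d e f f-uv u∈e v∈e u′∈f) u′∉e

straddles-∪ : ∀ {t} → DistinctR t → (e f : Pos t) {L M : Pred ℕ 0ℓ} →
              Straddles f L → Straddles f M → Straddles e (L ∪ M) →
              Straddles e L ⊎ Straddles e M
straddles-∪ _ _ _ _ _ (_ , _ , inj₁ a∈L , inj₁ b∈L , e-ab) =
  inj₁ (_ , _ , a∈L , b∈L , e-ab)
straddles-∪ _ _ _ _ _ (_ , _ , inj₂ a∈M , inj₂ b∈M , e-ab) =
  inj₂ (_ , _ , a∈M , b∈M , e-ab)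
straddles-∪ d e f fL fM (_ , _ , inj₁ a∈L , inj₂ b∈M , e-ab) =
  straddles-across d e f fL fM a∈L b∈M e-ab
straddles-∪ d e f fL fM (_ , _ , inj₂ a∈M , inj₁ b∈L , e-ab) =
  swap (straddles-across d e f fM fL a∈M b∈L e-ab)

separated⇒straddles : ∀ {t} {L : Pred ℕ 0ℓ} (e : Pos t) {u v : ℕ} → L u → L v →
                      Separates e u v ⊎ Separates e v u → Straddles e L
separated⇒straddles _ u∈L v∈L (inj₁ e-uv) = _ , _ , u∈L , v∈L , e-uv
separated⇒straddles _ u∈L v∈L (inj₂ e-vu) = _ , _ , v∈L , u∈L , e-vu

straddles⇒on-restr-path :
  ∀ r {t} (L₁ L₂ : Pred ℕ 0ℓ) (ε : RestrEdge (rooted r t) (L₁ ∪ L₂)) →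
  Straddles (proj₁ ε) L₁ ⊎ Straddles (proj₁ ε) L₂ →
  ∃[ u ] ∃[ v ] ((L₁ u × L₁ v) ⊎ (L₂ u × L₂ v)) ×
    OnRestrPath (rooted r t) (L₁ ∪ L₂) ε u v
straddles⇒on-restr-path _ _ _ _ (inj₁ (u , v , u∈L₁ , v∈L₁ , e-uv)) =
  u , v , inj₁ (u∈L₁ , v∈L₁) , inj₁ u∈L₁ , inj₁ v∈L₁ , inj₁ e-uv
straddles⇒on-restr-path _ _ _ _ (inj₂ (u , v , u∈L₂ , v∈L₂ , e-uv)) =
  u , v , inj₂ (u∈L₂ , v∈L₂) , inj₂ u∈L₂ , inj₂ v∈L₂ , inj₁ e-uv

lemma8 : (T : BinTree) → WellLabelled T →
         (L₁ L₂ : ℕ → Set) → L₁ ⊆Leaves T → L₂ ⊆Leaves T →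
         EdgeSharing T L₁ L₂ →
         (ε : RestrEdge T (L₁ ∪ L₂)) →
         ∃[ u ] ∃[ v ] ((L₁ u × L₁ v) ⊎ (L₂ u × L₂ v)) ×
           OnRestrPath T (L₁ ∪ L₂) ε u v
lemma8 (single _) _ _ _ _ _ _ (() , _)
lemma8 (rooted r t) (distinct , _) L₁ L₂ _ _
       (_ , _ , _ , _ , f , u₁∈L₁ , v₁∈L₁ , u₂∈L₂ , v₂∈L₂ , f-u₁v₁ , f-u₂v₂)
       ε@(e , _ , _ , x∈L , y∈L , e-xy) =
  straddles⇒on-restr-path r L₁ L₂ ε
    (straddles-∪ distinct e f
      (separated⇒straddles f u₁∈L₁ v₁∈L₁ f-u₁v₁)
      (separated⇒straddles f u₂∈L₂ v₂∈L₂ f-u₂v₂)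
      (separated⇒straddles e x∈L y∈L e-xy))
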